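{- Let $t,u$ be CBV terms and $s'$ a Bang term. 1. (Stability) If $t^{v}\to_S^* s'$ and $s'$ is an $S\langle d!\rangle$-normal form, then $s'=s^{v}$ for some CBV term $s$. 2. (Normal forms) $t$ is a normal form for CBV surface reduction if and only if $t^{v}$ is a normal form for Bang surface reduction $\to_S$. 3. (Simulations) $t\to_S^* u$ in CBV if and only if $t^{v}\to_S^* u^{v}$ in the Distant Bang Calculus. Moreover, the number of $dB$/$sV$-steps on the left matches the number of $dB$/$s!$-steps on the right.
   Context: Distant Bang Calculus. Terms: $t,u,s ::= x \mid t\,u \mid \lambda x.t \mid !t \mid \mathrm{der}(t) \mid t[x\backslash u]$; $\lambda x.t$ and $t[x\backslash u]$ bind $x$ in $t$; terms up to $\alpha$-conversion; $t\{x:=u\}$ is capture-avoiding substitution. Contexts have exactly one hole $\square$, $C\langle t\rangle$ is plugging. Surface contexts: $S ::= \square \mid S\,t \mid t\,S \mid \lambda x.S \mid \mathrm{der}(S) \mid S[x\backslash t] \mid t[x\backslash S]$ (hole not under a $!$); list contexts $L ::= \square \mid L[x\backslash t]$. Rules (capture-free w.r.t. $L$): $(dB)$ $L\langle \lambda x.t\rangle\,u \mapsto L\langle t[x\backslash u]\rangle$; $(s!)$ $t[x\backslash L\langle !u\rangle] \mapsto L\langle t\{x:=u\}\rangle$; $(d!)$ $\mathrm{der}(L\langle !t\rangle) \mapsto L\langle t\rangle$. Surface reduction $\to_S$: closure of the three rules under surface contexts; an $S\langle d!\rangle$-normal form is a term with no $d!$-step in any surface context. CBV calculus. Terms $t,u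 ::= v \mid t\,u \mid t[x\backslash u]$, values $v ::= x \mid \lambda x.t$; list contexts $L ::= \square \mid L[x\backslash t]$; surface contexts $V ::= \square \mid V\,t \mid t\,V \mid V[x\backslash t] \mid t[x\backslash V]$ (hole not under a $\lambda$). Rules (capture-free): $(dB)$ $L\langle \lambda x.t\rangle\,u \mapsto L\langle t[x\backslash u]\rangle$, $(sV)$ $t[x\backslash L\langle v\rangle]\mapsto L\langle t\{x:=v\}\rangle$ with $v$ a value. CBV surface reduction: closure of $dB$, $sV$ under CBV surface contexts. CBV embedding $(\cdot)^v$: $x^v=!x$; $(\lambda x.t)^v=!\lambda x.!t^v$; $(t[x\backslash u])^v=t^v[x\backslash u^v]$; $(t\,u)^v=\mathrm{der}(L\langle s\rangle\,u^v)$ if $t^v=L\langle !s\rangle$ for some list context $L$ and term $s$, and $(t\,u)^v=\mathrm{der}(\mathrm{der}(t^v)\,u^v)$ otherwise. -}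

module Defs where

-- Well-scoped de Bruijn syntax: a term of type `Tm n` has free variables
-- among `Fin n`.  Alpha-equivalence is thus syntactic equality, and all
-- "capture-free" side conditions are realised by explicit weakening.

open import Data.Nat using (ℕ; zero; suc; _+_)
open import Data.Fin using (Fin; zero; suc)
open import Data.Maybe using (Maybe; just; nothing)
open import Data.Product using (Σ; ∃; _,_; _×_)
open import Relation.Nullary using (¬_)
open import Relation.Binary.Construct.Closure.ReflexiveTransitive using (Star; ε; _◅_)

ext : ∀ {n m} → (Fin n → Fin m) → Fin (suc n) → Fin (suc m)
ext ρ zero    = zero
ext ρ (suc i) = suc (ρ i)

data BTm (n : ℕ) : Set where
  var  : Fin n → BTm n
  app  : BTm n → BTm n → BTm n
  lam  : BTm (suc n) → BTm n
  bang : BTm n → BTm n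
  der  : BTm n → BTm n
  es   : BTm (suc n) → BTm n → BTm n    -- es t u  =  t[x\u]

renB : ∀ {n m} → (Fin n → Fin m) → BTm n → BTm m
renB ρ (var x)  = var (ρ x)
renB ρ (app t u) = app (renB ρ t) (renB ρ u)
renB ρ (lam t)  = lam (renB (ext ρ) t)
renB ρ (bang t) = bang (renB ρ t)
renB ρ (der t)  = der (renB ρ t)
renB ρ (es t u) = es (renB (ext ρ) t) (renB ρ u)

extsB : ∀ {n m} → (Fin n → BTm m) → Fin (suc n) → BTm (suc m)
extsB σ zero    = var zero
extsB σ (suc i) = renB suc (σ i)

substB : ∀ {n m} → (Fin n → BTm m) → BTm n → BTm m
substB σ (var x)  = σ x
substB σ (app t u) = app (substB σ t) (substB σ u)
substB σ (lam t)  = lam (substB (extsB σ) t)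
substB σ (bang t) = bang (substB σ t)
substB σ (der t)  = der (substB σ t)
substB σ (es t u) = es (substB (extsB σ) t) (substB σ u)

topB : ∀ {n} → BTm n → Fin (suc n) → BTm n
topB u zero    = u
topB u (suc i) = var i

_B[0:=_] : ∀ {n} → BTm (suc n) → BTm n → BTm n
t B[0:= u ] = substB (topB u) t

-- list contexts L ::= □ | L[x\t];  `BL n m`: outside scope n, hole scope m
data BL : ℕ → ℕ → Set where
  hole : ∀ {n} → BL n n
  sub  : ∀ {n m} → BL (suc n) m → BTm n → BL n m

plugB : ∀ {n m} → BL n m → BTm m → BTm n
plugB hole      t = t
plugB (sub L s) t = es (plugB L t) s

wkBL : ∀ {n m} → BL n m → Fin n → Fin m
wkBL hole      i = i
wkBL (sub L s) i = wkBL L (suc i)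

data BRule : Set where
  dB s! d! : BRule

data BRoot {n : ℕ} : BRule → BTm n → BTm n → Set where
  r-dB : ∀ {m} (L : BL n m) (t : BTm (suc m)) (u : BTm n) →
         BRoot dB (app (plugB L (lam t)) u) (plugB L (es t (renB (wkBL L) u)))
  r-s! : ∀ {m} (t : BTm (suc n)) (L : BL n m) (u : BTm m) →
         BRoot s! (es t (plugB L (bang u))) (plugB L ((renB (ext (wkBL L)) t) B[0:= u ]))
  r-d! : ∀ {m} (L : BL n m) (t : BTm m) →
         BRoot d! (der (plugB L (bang t))) (plugB L t)

data BStep : ∀ {n} → BRule → BTm n → BTm n → Set where
  root  : ∀ {n r} {t u : BTm n} → BRoot r t u → BStep r t u
  appL  : ∀ {n r} {t t' u : BTm n} → BStep r t t' → BStep r (app t u) (app t' u)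
  appR  : ∀ {n r} {t u u' : BTm n} → BStep r u u' → BStep r (app t u) (app t u')
  lamS  : ∀ {n r} {t t' : BTm (suc n)} → BStep r t t' → BStep r (lam t) (lam t')
  derS  : ∀ {n r} {t t' : BTm n} → BStep r t t' → BStep r (der t) (der t')
  esL   : ∀ {n r} {t t' : BTm (suc n)} {u : BTm n} → BStep r t t' → BStep r (es t u) (es t' u)
  esR   : ∀ {n r} {t : BTm (suc n)} {u u' : BTm n} → BStep r u u' → BStep r (es t u) (es t u')

_→S_ : ∀ {n} → BTm n → BTm n → Set
t →S u = Σ BRule λ r → BStep r t u

_→S*_ : ∀ {n} → BTm n → BTm n → Set
_→S*_ = Star _→S_

BNF : ∀ {n} → BTm n → Set
BNF t = ¬ (∃ λ u → t →S u)

Bd!NF : ∀ {n} → BTm n → Set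
Bd!NF t = ¬ (∃ λ u → BStep d! t u)

countB : ∀ {n} → BRule → {t u : BTm n} → t →S* u → ℕ
countB r ε = 0
countB dB ((dB , _) ◅ σ) = suc (countB dB σ)
countB s! ((s! , _) ◅ σ) = suc (countB s! σ)
countB d! ((d! , _) ◅ σ) = suc (countB d! σ)
countB r  ((_  , _) ◅ σ) = countB r σ

data VTm (n : ℕ) : Set where
  var : Fin n → VTm n
  lam : VTm (suc n) → VTm n
  app : VTm n → VTm n → VTm n
  es  : VTm (suc n) → VTm n → VTm n

data Value {n : ℕ} : VTm n → Set where
  v-var : (x : Fin n) → Value (var x)
  v-lam : (t : VTm (suc n)) → Value (lam t)

renV : ∀ {n m} → (Fin n → Fin m) → VTm n → VTm m
renV ρ (var x)  = var (ρ x)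
renV ρ (lam t)  = lam (renV (ext ρ) t)
renV ρ (app t u) = app (renV ρ t) (renV ρ u)
renV ρ (es t u) = es (renV (ext ρ) t) (renV ρ u)

extsV : ∀ {n m} → (Fin n → VTm m) → Fin (suc n) → VTm (suc m)
extsV σ zero    = var zero
extsV σ (suc i) = renV suc (σ i)

substV : ∀ {n m} → (Fin n → VTm m) → VTm n → VTm m
substV σ (var x)  = σ x
substV σ (lam t)  = lam (substV (extsV σ) t)
substV σ (app t u) = app (substV σ t) (substV σ u)
substV σ (es t u) = es (substV (extsV σ) t) (substV σ u)

topV : ∀ {n} → VTm n → Fin (suc n) → VTm n
topV u zero    = u
topV u (suc i) = var i

_V[0:=_] : ∀ {n} → VTm (suc n) → VTm n → VTm n
t V[0:= u ] = substV (topV u) t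

data VL : ℕ → ℕ → Set where
  hole : ∀ {n} → VL n n
  sub  : ∀ {n m} → VL (suc n) m → VTm n → VL n m

plugV : ∀ {n m} → VL n m → VTm m → VTm n
plugV hole      t = t
plugV (sub L s) t = es (plugV L t) s

wkVL : ∀ {n m} → VL n m → Fin n → Fin m
wkVL hole      i = i
wkVL (sub L s) i = wkVL L (suc i)

data VRule : Set where
  dB sV : VRule

data VRoot {n : ℕ} : VRule → VTm n → VTm n → Set where
  r-dB : ∀ {m} (L : VL n m) (t : VTm (suc m)) (u : VTm n) →
         VRoot dB (app (plugV L (lam t)) u) (plugV L (es t (renV (wkVL L) u)))
  r-sV : ∀ {m} (t : VTm (suc n)) (L : VL n m) (v : VTm m) → Value v →
         VRoot sV (es t (plugV L v)) (plugV L ((renV (ext (wkVL L)) t) V[0:= v ]))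

-- CBV surface closure: V ::= □ | V t | t V | V[x\t] | t[x\V]  (not under λ)
data VStep : ∀ {n} → VRule → VTm n → VTm n → Set where
  root  : ∀ {n r} {t u : VTm n} → VRoot r t u → VStep r t u
  appL  : ∀ {n r} {t t' u : VTm n} → VStep r t t' → VStep r (app t u) (app t' u)
  appR  : ∀ {n r} {t u u' : VTm n} → VStep r u u' → VStep r (app t u) (app t u')
  esL   : ∀ {n r} {t t' : VTm (suc n)} {u : VTm n} → VStep r t t' → VStep r (es t u) (es t' u)
  esR   : ∀ {n r} {t : VTm (suc n)} {u u' : VTm n} → VStep r u u' → VStep r (es t u) (es t u')

_→V_ : ∀ {n} → VTm n → VTm n → Set
t →V u = Σ VRule λ r → VStep r t u

_→V*_ : ∀ {n} → VTm n → VTm n → Set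
_→V*_ = Star _→V_

VNF : ∀ {n} → VTm n → Set
VNF t = ¬ (∃ λ u → t →V u)

countV : ∀ {n} → VRule → {t u : VTm n} → t →V* u → ℕ
countV r ε = 0
countV dB ((dB , _) ◅ σ) = suc (countV dB σ)
countV sV ((sV , _) ◅ σ) = suc (countV sV σ)
countV r  ((_  , _) ◅ σ) = countV r σ

-- strip (L⟨!s⟩) = just L⟨s⟩ ; strip t = nothing if t is not of that form
strip : ∀ {n} → BTm n → Maybe (BTm n)
strip (bang s) = just s
strip (es t u) with strip t
... | just r  = just (es r u)
... | nothing = nothing
strip _ = nothing

embApp : ∀ {n} → Maybe (BTm n) → BTm n → BTm n → BTm n
embApp (just r) tv uv = der (app r uv)
embApp nothing  tv uv = der (app (der tv) uv)

_ᵛ : ∀ {n} → VTm n → BTm n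
var x ᵛ   = bang (var x)
lam t ᵛ   = bang (lam (bang (t ᵛ)))
es t u ᵛ  = es (t ᵛ) (u ᵛ)
app t u ᵛ = embApp (strip (t ᵛ)) (t ᵛ) (u ᵛ)

-- The embedding is a simulation up to administrative d!-steps. A dB- or sV-step of t becomes
-- the corresponding dB- or s!-step of t ᵛ, possibly followed by one d!-step: the embedding of
-- an application fires the d!-redex der (L⟨! s⟩) at its head whenever the head has that shape,
-- and a step can create such a head. Conversely, a Bang reduction from t ᵛ is tracked by the
-- relation b ⊳ t, "b is t ᵛ with some of these d!-redexes still pending": d!-steps preserve it,
-- every dB- or s!-step of b is mirrored by a dB- or sV-step of t, the only d!-normal b with
-- b ⊳ t is t ᵛ, and erasing all bangs and ders maps b back to t. As t ᵛ is d!-normal, this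
-- yields stability, the step counts in both directions and the correspondence of normal forms.

module Submission where

open import Defs
open import Data.Nat using (ℕ; zero; suc; _+_)
open import Data.Nat.Properties using (+-assoc; +-identityʳ)
open import Data.Fin using (Fin; zero; suc)
open import Data.Maybe using (just; nothing)
open import Data.Product using (Σ; ∃; _×_; _,_; proj₁)
open import Data.Empty using (⊥; ⊥-elim)
open import Relation.Nullary using (¬_; Dec; yes; no)
open import Relation.Binary.PropositionalEquality
  using (_≡_; _≢_; _≗_; refl; sym; trans; cong; cong₂; subst; subst₂; module ≡-Reasoning)
open import Relation.Binary.Construct.Closure.ReflexiveTransitive using (ε; _◅_; _◅◅_)
open import Function.Bundles using (_⇔_; mk⇔)

private
  variable
    n m k l k' l' : ℕ
    κ : BRule
    a a' b b' c c' r r' w : BTm n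
    t t' t₁ u v : VTm n
    σ : Fin n → VTm m
    σ' : Fin n → BTm m
    L : BL n m
    L' : VL n m

hit : BRule → BRule → ℕ
hit dB dB = 1
hit s! s! = 1
hit d! d! = 1
hit _  _  = 0

countB-◅ : ∀ q (s : BStep κ a b) (τ : b →S* c) → countB q ((κ , s) ◅ τ) ≡ hit q κ + countB q τ
countB-◅ {κ = dB} dB _ _ = refl
countB-◅ {κ = s!} dB _ _ = refl
countB-◅ {κ = d!} dB _ _ = refl
countB-◅ {κ = dB} s! _ _ = refl
countB-◅ {κ = s!} s! _ _ = refl
countB-◅ {κ = d!} s! _ _ = refl
countB-◅ {κ = dB} d! _ _ = refl
countB-◅ {κ = s!} d! _ _ = refl
countB-◅ {κ = d!} d! _ _ = refl

countB-◅◅ : ∀ q (τ : a →S* b) (τ' : b →S* c) → countB q (τ ◅◅ τ') ≡ countB q τ + countB q τ'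
countB-◅◅ q ε τ' = refl
countB-◅◅ q ((κ , s) ◅ τ) τ' = begin
  countB q ((κ , s) ◅ (τ ◅◅ τ'))       ≡⟨ countB-◅ q s (τ ◅◅ τ') ⟩
  hit q κ + countB q (τ ◅◅ τ')         ≡⟨ cong (hit q κ +_) (countB-◅◅ q τ τ') ⟩
  hit q κ + (countB q τ + countB q τ') ≡⟨ sym (+-assoc (hit q κ) _ _) ⟩
  hit q κ + countB q τ + countB q τ'   ≡⟨ cong (_+ countB q τ') (sym (countB-◅ q s τ)) ⟩
  countB q ((κ , s) ◅ τ) + countB q τ' ∎
  where open ≡-Reasoning

infix 4 _→S*[_,_]_ _→V*[_,_]_

_→S*[_,_]_ : BTm n → ℕ → ℕ → BTm n → Set
a →S*[ k , l ] b = Σ (a →S* b) λ τ → countB dB τ ≡ k × countB s! τ ≡ l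

_→V*[_,_]_ : VTm n → ℕ → ℕ → VTm n → Set
t →V*[ k , l ] u = Σ (t →V* u) λ σ → countV dB σ ≡ k × countV sV σ ≡ l

ε[] : a →S*[ 0 , 0 ] a
ε[] = ε , refl , refl

_◅◅[]_ : a →S*[ k , l ] b → b →S*[ k' , l' ] c → a →S*[ k + k' , l + l' ] c
(τ , refl , refl) ◅◅[] (τ' , refl , refl) = τ ◅◅ τ' , countB-◅◅ dB τ τ' , countB-◅◅ s! τ τ'

step[] : BStep κ a b → a →S*[ hit dB κ , hit s! κ ] b
step[] {κ = dB} s = (dB , s) ◅ ε , refl , refl
step[] {κ = s!} s = (s! , s) ◅ ε , refl , refl
step[] {κ = d!} s = (d! , s) ◅ ε , refl , refl

_▻d!_ : a →S*[ k , l ] b → BStep d! b c → a →S*[ k , l ] c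
τ ▻d! s = subst₂ (λ k l → _ →S*[ k , l ] _) (+-identityʳ _) (+-identityʳ _) (τ ◅◅[] step[] s)

module _ {R : BTm n → BTm m → Set}
         (sim : ∀ {κ a a' b} → R a a' → BStep κ a b → ∃ λ b' → R b b' × BStep κ a' b') where

  lockstep : R a a' → a →S*[ k , l ] b → ∃ λ b' → R b b' × a' →S*[ k , l ] b'
  lockstep rel (τ , refl , refl) = go rel τ
    where
    go : R a a' → (τ : a →S* b) → ∃ λ b' → R b b' × a' →S*[ countB dB τ , countB s! τ ] b'
    go rel ε = _ , rel , ε[]
    go rel ((κ , s) ◅ τ) with sim rel s
    ... | _ , rel₁ , s' with go rel₁ τ
    ... | b' , rel' , τ' rewrite countB-◅ dB s τ | countB-◅ s! s τ = b' , rel' , step[] s' ◅◅[] τ'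

map[] : (f : BTm n → BTm m) → (∀ {κ a b} → BStep κ a b → BStep κ (f a) (f b)) →
        a →S*[ k , l ] b → f a →S*[ k , l ] f b
map[] f F τ with lockstep {R = λ a a' → f a ≡ a'} (λ { refl s → _ , refl , F s }) refl τ
... | _ , refl , τ' = τ'

-- `Unbang b r`: b = L⟨! s⟩ and r = L⟨s⟩ for a list context L; it is the graph of `strip`.
data Unbang : BTm n → BTm n → Set where
  bang : (s : BTm n) → Unbang (bang s) s
  es   : {b r : BTm (suc n)} (c : BTm n) → Unbang b r → Unbang (es b c) (es r c)

Unbangable : BTm n → Set
Unbangable b = ∃ (Unbang b)

unbang⇒strip : Unbang b r → strip b ≡ just r
unbang⇒strip (bang s) = refl
unbang⇒strip (es c p) rewrite unbang⇒strip p = refl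

strip⇒unbang : strip b ≡ just r → Unbang b r
strip⇒unbang {b = bang s} refl = bang s
strip⇒unbang {b = es b c} eq with strip b in eq'
strip⇒unbang {b = es b c} refl | just _ = es c (strip⇒unbang eq')
strip⇒unbang {b = es b c} ()   | nothing

¬unbangable⇒strip : ¬ Unbangable b → strip b ≡ nothing
¬unbangable⇒strip {b = b} ¬p with strip b in eq
... | just r  = ⊥-elim (¬p (r , strip⇒unbang eq))
... | nothing = refl

unbangable? : (b : BTm n) → Dec (Unbangable b)
unbangable? b with strip b in eq
... | just r  = yes (r , strip⇒unbang eq)
... | nothing = no λ (_ , p) → nothing≢just (trans (sym eq) (unbang⇒strip p))
  where
  nothing≢just : nothing ≢ just r
  nothing≢just ()

unbang-unique : Unbang b r → Unbang b r' → r ≡ r'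
unbang-unique (bang s) (bang s) = refl
unbang-unique (es c p) (es c q) = cong (λ z → es z c) (unbang-unique p q)

unbang-plug : (L : BL n m) → Unbang b r → Unbang (plugB L b) (plugB L r)
unbang-plug hole      p = p
unbang-plug (sub L c) p = es c (unbang-plug L p)

unbang⇒plug : Unbang b r → ∃ λ m → Σ (BL n m) λ L → ∃ λ s → b ≡ plugB L (bang s) × r ≡ plugB L s
unbang⇒plug (bang s) = _ , hole , s , refl , refl
unbang⇒plug (es c p) with unbang⇒plug p
... | _ , L , s , refl , refl = _ , sub L c , s , refl , refl

unbang-d! : Unbang b r → BStep d! (der b) r
unbang-d! p with unbang⇒plug p
... | _ , L , s , refl , refl = root (r-d! L s)

unbang-ren : (ρ : Fin n → Fin m) → Unbang b r → Unbang (renB ρ b) (renB ρ r)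
unbang-ren ρ (bang s) = bang (renB ρ s)
unbang-ren ρ (es c p) = es (renB ρ c) (unbang-ren (ext ρ) p)

unbang-subst : (σ : Fin n → BTm m) → Unbang b r → Unbang (substB σ b) (substB σ r)
unbang-subst σ (bang s) = bang (substB σ s)
unbang-subst σ (es c p) = es (substB σ c) (unbang-subst (extsB σ) p)

unbangable-ren⁻¹ : (ρ : Fin n → Fin m) (b : BTm n) → Unbang (renB ρ b) r → Unbangable b
unbangable-ren⁻¹ ρ (bang s) _ = s , bang s
unbangable-ren⁻¹ ρ (es b c) (es _ p) with unbangable-ren⁻¹ (ext ρ) b p
... | r , q = es r c , es c q

¬unbangable-exts : (σ : Fin n → BTm m) → (∀ i → ¬ Unbangable (σ i)) → ∀ i → ¬ Unbangable (extsB σ i)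
¬unbangable-exts σ inert zero    (_ , ())
¬unbangable-exts σ inert (suc i) (_ , p) = inert i (unbangable-ren⁻¹ suc (σ i) p)

unbangable-subst⁻¹ : (σ : Fin n → BTm m) → (∀ i → ¬ Unbangable (σ i)) →
                     (b : BTm n) → Unbang (substB σ b) r → Unbangable b
unbangable-subst⁻¹ σ inert (var i)  p = ⊥-elim (inert i (_ , p))
unbangable-subst⁻¹ σ inert (bang s) _ = s , bang s
unbangable-subst⁻¹ σ inert (es b c) (es _ p) with unbangable-subst⁻¹ (extsB σ) (¬unbangable-exts σ inert) b p
... | r , q = es r c , es c q

unbang-s!-contractum : (L : BL n m) (w : BTm m) → Unbang b r →
  Unbang (plugB L (renB (ext (wkBL L)) b B[0:= w ])) (plugB L (renB (ext (wkBL L)) r B[0:= w ]))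
unbang-s!-contractum L w p = unbang-plug L (unbang-subst (topB w) (unbang-ren (ext (wkBL L)) p))

unbang-step : Unbang b r → BStep κ b b' → ∃ λ r' → Unbang b' r' × BStep κ r r'
unbang-step (bang s) (root ())
unbang-step (es c p) (root (r-s! _ L w)) = _ , unbang-s!-contractum L w p , root (r-s! _ L w)
unbang-step (es c p) (esL s) with unbang-step p s
... | _ , p' , s' = _ , es c p' , esL s'
unbang-step (es c p) (esR s) = _ , es _ p , esR s

appᵛ : BTm n → BTm n → BTm n
appᵛ a c = embApp (strip a) a c

appᵛ-unbang : ∀ c → Unbang a r → appᵛ a c ≡ der (app r c)
appᵛ-unbang {a = a} c p = cong (λ z → embApp z a c) (unbang⇒strip p)

appᵛ-stuck : ∀ c → ¬ Unbangable a → appᵛ a c ≡ der (app (der a) c)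
appᵛ-stuck {a = a} c ¬p = cong (λ z → embApp z a c) (¬unbangable⇒strip ¬p)

appᵛ-elim : (P : BTm n → Set) (a c : BTm n) →
            (∀ {r} → Unbang a r → P (der (app r c))) →
            (¬ Unbangable a → P (der (app (der a) c))) →
            P (appᵛ a c)
appᵛ-elim P a c unbanged stuck with unbangable? a
... | yes (_ , p) = subst P (sym (appᵛ-unbang c p)) (unbanged p)
... | no ¬p       = subst P (sym (appᵛ-stuck c ¬p)) (stuck ¬p)

renB-appᵛ : (ρ : Fin n → Fin m) (a c : BTm n) → renB ρ (appᵛ a c) ≡ appᵛ (renB ρ a) (renB ρ c)
renB-appᵛ ρ a c = appᵛ-elim (λ z → renB ρ z ≡ appᵛ (renB ρ a) (renB ρ c)) a c
  (λ p → sym (appᵛ-unbang _ (unbang-ren ρ p)))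
  (λ ¬p → sym (appᵛ-stuck _ λ (_ , p) → ¬p (unbangable-ren⁻¹ ρ a p)))

substB-appᵛ : (σ : Fin n → BTm m) → (∀ i → ¬ Unbangable (σ i)) →
              (a c : BTm n) → substB σ (appᵛ a c) ≡ appᵛ (substB σ a) (substB σ c)
substB-appᵛ σ inert a c = appᵛ-elim (λ z → substB σ z ≡ appᵛ (substB σ a) (substB σ c)) a c
  (λ p → sym (appᵛ-unbang _ (unbang-subst σ p)))
  (λ ¬p → sym (appᵛ-stuck _ λ (_ , p) → ¬p (unbangable-subst⁻¹ σ inert a p)))

appᵛ-congʳ : ∀ a → c →S*[ k , l ] c' → appᵛ a c →S*[ k , l ] appᵛ a c'
appᵛ-congʳ {c = c} {c' = c'} a τ with unbangable? a
... | yes (r , p) rewrite appᵛ-unbang c p | appᵛ-unbang c' p =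
  map[] (λ z → der (app r z)) (λ s → derS (appR s)) τ
... | no ¬p rewrite appᵛ-stuck c ¬p | appᵛ-stuck c' ¬p =
  map[] (λ z → der (app (der a) z)) (λ s → derS (appR s)) τ

appᵛ-congˡ : ∀ c → a →S*[ k , l ] a' → appᵛ a c →S*[ k , l ] appᵛ a' c
appᵛ-congˡ {a = a} {k = k} {l = l} {a' = a'} c τ =
  appᵛ-elim (λ z → z →S*[ k , l ] appᵛ a' c) a c unbanged stuck
  where
  unbanged : Unbang a r → der (app r c) →S*[ k , l ] appᵛ a' c
  unbanged p with lockstep unbang-step p τ
  ... | r' , p' , τ' = subst (der (app _ c) →S*[ k , l ]_) (sym (appᵛ-unbang c p'))
                         (map[] (λ z → der (app z c)) (λ s → derS (appL s)) τ')
  stuck : ¬ Unbangable a → der (app (der a) c) →S*[ k , l ] appᵛ a' c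
  stuck _ = appᵛ-elim (der (app (der a) c) →S*[ k , l ]_) a' c
    (λ p' → τ' ▻d! derS (appL (unbang-d! p')))
    (λ _ → τ')
    where
    τ' : der (app (der a) c) →S*[ k , l ] der (app (der a') c)
    τ' = map[] (λ z → der (app (der z) c)) (λ s → derS (appL (derS s))) τ

erase : BTm n → VTm n
erase (var x)   = var x
erase (app b c) = app (erase b) (erase c)
erase (lam b)   = lam (erase b)
erase (bang b)  = erase b
erase (der b)   = erase b
erase (es b c)  = es (erase b) (erase c)

erase-unbang : Unbang b r → erase b ≡ erase r
erase-unbang (bang s) = refl
erase-unbang (es c p) = cong (λ z → es z (erase c)) (erase-unbang p)

erase-ᵛ : (t : VTm n) → erase (t ᵛ) ≡ t
erase-ᵛ (var x)   = refl
erase-ᵛ (lam t)   = cong lam (erase-ᵛ t)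
erase-ᵛ (es t u)  = cong₂ es (erase-ᵛ t) (erase-ᵛ u)
erase-ᵛ (app t u) = appᵛ-elim (λ z → erase z ≡ app t u) (t ᵛ) (u ᵛ)
  (λ p → cong₂ app (trans (sym (erase-unbang p)) (erase-ᵛ t)) (erase-ᵛ u))
  (λ _ → cong₂ app (erase-ᵛ t) (erase-ᵛ u))

ext-cong : {ρ ρ' : Fin n → Fin m} → ρ ≗ ρ' → ext ρ ≗ ext ρ'
ext-cong h zero    = refl
ext-cong h (suc i) = cong suc (h i)

renV-cong : {ρ ρ' : Fin n → Fin m} → ρ ≗ ρ' → renV ρ ≗ renV ρ'
renV-cong h (var x)   = cong var (h x)
renV-cong h (lam t)   = cong lam (renV-cong (ext-cong h) t)
renV-cong h (app t u) = cong₂ app (renV-cong h t) (renV-cong h u)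
renV-cong h (es t u)  = cong₂ es (renV-cong (ext-cong h) t) (renV-cong h u)

ᵛ-ren : (ρ : Fin n → Fin m) (t : VTm n) → renV ρ t ᵛ ≡ renB ρ (t ᵛ)
ᵛ-ren ρ (var x)   = refl
ᵛ-ren ρ (lam t)   = cong (λ z → bang (lam (bang z))) (ᵛ-ren (ext ρ) t)
ᵛ-ren ρ (es t u)  = cong₂ es (ᵛ-ren (ext ρ) t) (ᵛ-ren ρ u)
ᵛ-ren ρ (app t u) = trans (cong₂ appᵛ (ᵛ-ren ρ t) (ᵛ-ren ρ u)) (sym (renB-appᵛ ρ (t ᵛ) (u ᵛ)))

¬unbangable-ᵛ-body : (v : VTm n) → bang w ≡ v ᵛ → ¬ Unbangable w
¬unbangable-ᵛ-body (var x)   refl (_ , ())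
¬unbangable-ᵛ-body (lam t)   refl (_ , ())
¬unbangable-ᵛ-body (app t u) eq   = ⊥-elim (appᵛ-elim (λ z → bang _ ≢ z) (t ᵛ) (u ᵛ) (λ _ ()) (λ _ ()) eq)

-- σ' maps each variable to the embedding of a value minus its outer bang, as in the s!-rule.
infix 4 _≈ᵛ_

_≈ᵛ_ : (Fin n → BTm m) → (Fin n → VTm m) → Set
σ' ≈ᵛ σ = ∀ i → bang (σ' i) ≡ σ i ᵛ

exts-≈ᵛ : σ' ≈ᵛ σ → extsB σ' ≈ᵛ extsV σ
exts-≈ᵛ         h zero    = refl
exts-≈ᵛ {σ = σ} h (suc i) = trans (cong (renB suc) (h i)) (sym (ᵛ-ren suc (σ i)))

top-≈ᵛ : bang w ≡ v ᵛ → topB w ≈ᵛ topV v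
top-≈ᵛ eq zero    = eq
top-≈ᵛ eq (suc i) = refl

ᵛ-subst : σ' ≈ᵛ σ → ∀ t → substV σ t ᵛ ≡ substB σ' (t ᵛ)
ᵛ-subst h (var x)   = sym (h x)
ᵛ-subst h (lam t)   = cong (λ z → bang (lam (bang z))) (ᵛ-subst (exts-≈ᵛ h) t)
ᵛ-subst h (es t u)  = cong₂ es (ᵛ-subst (exts-≈ᵛ h) t) (ᵛ-subst h u)
ᵛ-subst {σ' = σ'} {σ = σ} h (app t u) =
  trans (cong₂ appᵛ (ᵛ-subst h t) (ᵛ-subst h u))
        (sym (substB-appᵛ σ' (λ i → ¬unbangable-ᵛ-body (σ i) (h i)) (t ᵛ) (u ᵛ)))

embL : VL n m → BL n m
embL hole      = hole
embL (sub L u) = sub (embL L) (u ᵛ)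

ᵛ-plug : (L : VL n m) (t : VTm m) → plugV L t ᵛ ≡ plugB (embL L) (t ᵛ)
ᵛ-plug hole      t = refl
ᵛ-plug (sub L u) t = cong (λ z → es z (u ᵛ)) (ᵛ-plug L t)

wkVL≗wkBL-embL : (L : VL n m) → wkVL L ≗ wkBL (embL L)
wkVL≗wkBL-embL hole      i = refl
wkVL≗wkBL-embL (sub L u) i = wkVL≗wkBL-embL L (suc i)

-- The dB-step leaves the d!-redex der (L⟨(! t ᵛ)[x\u ᵛ]⟩), already fired by the embedding.
ᵛ-simulates-dB : (L : VL n m) (t : VTm (suc m)) (u : VTm n) →
  app (plugV L (lam t)) u ᵛ →S*[ 1 , 0 ] plugV L (es t (renV (wkVL L) u)) ᵛ
ᵛ-simulates-dB L t u = subst₂ (_→S*[ 1 , 0 ]_) (sym redex) (sym contractum)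
  (step[] (derS (root (r-dB (embL L) (bang (t ᵛ)) (u ᵛ))))
    ▻d! unbang-d! (unbang-plug (embL L) (es _ (bang (t ᵛ)))))
  where
  open ≡-Reasoning
  redex : app (plugV L (lam t)) u ᵛ ≡ der (app (plugB (embL L) (lam (bang (t ᵛ)))) (u ᵛ))
  redex = appᵛ-unbang (u ᵛ) (subst (λ z → Unbang z (plugB (embL L) (lam (bang (t ᵛ)))))
                                   (sym (ᵛ-plug L (lam t))) (unbang-plug (embL L) (bang _)))
  contractum : plugV L (es t (renV (wkVL L) u)) ᵛ ≡ plugB (embL L) (es (t ᵛ) (renB (wkBL (embL L)) (u ᵛ)))
  contractum = begin
    plugV L (es t (renV (wkVL L) u)) ᵛ
      ≡⟨ ᵛ-plug L _ ⟩
    plugB (embL L) (es (t ᵛ) (renV (wkVL L) u ᵛ))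
      ≡⟨ cong (λ z → plugB (embL L) (es (t ᵛ) (z ᵛ))) (renV-cong (wkVL≗wkBL-embL L) u) ⟩
    plugB (embL L) (es (t ᵛ) (renV (wkBL (embL L)) u ᵛ))
      ≡⟨ cong (λ z → plugB (embL L) (es (t ᵛ) z)) (ᵛ-ren _ u) ⟩
    plugB (embL L) (es (t ᵛ) (renB (wkBL (embL L)) (u ᵛ))) ∎

value-ᵛ : Value v → ∃ λ w → bang w ≡ v ᵛ
value-ᵛ (v-var x) = var x , refl
value-ᵛ (v-lam t) = lam (bang (t ᵛ)) , refl

ᵛ-simulates-sV : (t : VTm (suc n)) (L : VL n m) → Value v →
  es t (plugV L v) ᵛ →S*[ 0 , 1 ] plugV L (renV (ext (wkVL L)) t V[0:= v ]) ᵛ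
ᵛ-simulates-sV {v = v} t L val with value-ᵛ val
... | w , eq = subst₂ (_→S*[ 0 , 1 ]_) (sym redex) (sym contractum) (step[] (root (r-s! (t ᵛ) (embL L) w)))
  where
  open ≡-Reasoning
  redex : es t (plugV L v) ᵛ ≡ es (t ᵛ) (plugB (embL L) (bang w))
  redex = cong (es (t ᵛ)) (trans (ᵛ-plug L v) (cong (plugB (embL L)) (sym eq)))
  contractum : plugV L (renV (ext (wkVL L)) t V[0:= v ]) ᵛ ≡
               plugB (embL L) (renB (ext (wkBL (embL L))) (t ᵛ) B[0:= w ])
  contractum = begin
    plugV L (renV (ext (wkVL L)) t V[0:= v ]) ᵛ
      ≡⟨ ᵛ-plug L _ ⟩
    plugB (embL L) (renV (ext (wkVL L)) t V[0:= v ] ᵛ)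
      ≡⟨ cong (plugB (embL L)) (ᵛ-subst {σ = topV v} (top-≈ᵛ eq) (renV _ t)) ⟩
    plugB (embL L) (renV (ext (wkVL L)) t ᵛ B[0:= w ])
      ≡⟨ cong (λ z → plugB (embL L) (z ᵛ B[0:= w ])) (renV-cong (ext-cong (wkVL≗wkBL-embL L)) t) ⟩
    plugB (embL L) (renV (ext (wkBL (embL L))) t ᵛ B[0:= w ])
      ≡⟨ cong (λ z → plugB (embL L) (z B[0:= w ])) (ᵛ-ren _ t) ⟩
    plugB (embL L) (renB (ext (wkBL (embL L))) (t ᵛ) B[0:= w ]) ∎

hitV : VRule → VRule → ℕ
hitV dB dB = 1
hitV sV sV = 1
hitV _  _  = 0

ᵛ-simulates-step : {ρ : VRule} → VStep ρ t t' → t ᵛ →S*[ hitV dB ρ , hitV sV ρ ] t' ᵛ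
ᵛ-simulates-step (root (r-dB L t u))     = ᵛ-simulates-dB L t u
ᵛ-simulates-step (root (r-sV t L _ val)) = ᵛ-simulates-sV t L val
ᵛ-simulates-step (appL {u = u} s)        = appᵛ-congˡ (u ᵛ) (ᵛ-simulates-step s)
ᵛ-simulates-step (appR {t = t} s)        = appᵛ-congʳ (t ᵛ) (ᵛ-simulates-step s)
ᵛ-simulates-step (esL {u = u} s)         = map[] (λ z → es z (u ᵛ)) esL (ᵛ-simulates-step s)
ᵛ-simulates-step (esR {t = t} s)         = map[] (es (t ᵛ)) esR (ᵛ-simulates-step s)

ᵛ-simulates : (σ : t →V* u) → t ᵛ →S*[ countV dB σ , countV sV σ ] u ᵛ
ᵛ-simulates ε                = ε[]
ᵛ-simulates ((dB , s) ◅ σ) = ᵛ-simulates-step s ◅◅[] ᵛ-simulates σ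
ᵛ-simulates ((sV , s) ◅ σ) = ᵛ-simulates-step s ◅◅[] ᵛ-simulates σ

-- Pending d!-redexes: an application head still under `der` (`app`) and `der (L⟨! s⟩)` (`der`).
infix 4 _⊳_ _⊳L_

data _⊳_ : BTm n → VTm n → Set where
  var  : (x : Fin n) → bang (var x) ⊳ var x
  lam  : (t : VTm (suc n)) → bang (lam (bang (t ᵛ))) ⊳ lam t
  es   : b ⊳ t → c ⊳ u → es b c ⊳ es t u
  app  : b ⊳ t → c ⊳ u → der (app (der b) c) ⊳ app t u
  app! : b ⊳ t → Unbang b r → c ⊳ u → der (app r c) ⊳ app t u
  der  : Unbang b r → r ⊳ t → der b ⊳ t

data _⊳L_ : BL n m → VL n m → Set where
  hole : hole {n} ⊳L hole
  sub  : L ⊳L L' → c ⊳ u → sub L c ⊳L sub L' u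

⊳-refl : (t : VTm n) → t ᵛ ⊳ t
⊳-refl (var x)   = var x
⊳-refl (lam t)   = lam t
⊳-refl (es t u)  = es (⊳-refl t) (⊳-refl u)
⊳-refl (app t u) = appᵛ-elim (_⊳ app t u) (t ᵛ) (u ᵛ)
  (λ p → app! (⊳-refl t) p (⊳-refl u))
  (λ _ → app (⊳-refl t) (⊳-refl u))

⊳-erase : b ⊳ t → erase b ≡ t
⊳-erase (var x)      = refl
⊳-erase (lam t)      = cong lam (erase-ᵛ t)
⊳-erase (es p q)     = cong₂ es (⊳-erase p) (⊳-erase q)
⊳-erase (app p q)    = cong₂ app (⊳-erase p) (⊳-erase q)
⊳-erase (app! p e q) = cong₂ app (trans (sym (erase-unbang e)) (⊳-erase p)) (⊳-erase q)
⊳-erase (der e p)    = trans (erase-unbang e) (⊳-erase p)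

⊳-bang-value : bang w ⊳ v → Value v
⊳-bang-value (var x) = v-var x
⊳-bang-value (lam t) = v-lam t

⊳-bang-ᵛ : bang w ⊳ v → bang w ≡ v ᵛ
⊳-bang-ᵛ (var x) = refl
⊳-bang-ᵛ (lam t) = refl

⊳L-wk : L ⊳L L' → wkBL L ≗ wkVL L'
⊳L-wk hole      i = refl
⊳L-wk (sub R _) i = ⊳L-wk R (suc i)

⊳-plug : L ⊳L L' → b ⊳ t → plugB L b ⊳ plugV L' t
⊳-plug hole      p = p
⊳-plug (sub R q) p = es (⊳-plug R p) q

⊳-plug⁻¹ : (L : BL n m) → plugB L b ⊳ t →
  Σ (VL n m) λ L' → ∃ λ t₀ → L ⊳L L' × t ≡ plugV L' t₀ × b ⊳ t₀
⊳-plug⁻¹ hole      p        = hole , _ , hole , refl , p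
⊳-plug⁻¹ (sub L c) (es p q) with ⊳-plug⁻¹ L p
... | L' , t₀ , R , refl , p₀ = sub L' _ , t₀ , sub R q , refl , p₀

⊳-unbang-lam : (L : BL n m) {body : BTm (suc m)} → Unbang b (plugB L (lam body)) → b ⊳ t →
  Σ (VL n m) λ L' → ∃ λ t₁ → L ⊳L L' × t ≡ plugV L' (lam t₁) × body ≡ bang (t₁ ᵛ)
⊳-unbang-lam hole      (bang _) (lam t)  = hole , t , hole , refl , refl
⊳-unbang-lam (sub L c) (es _ e) (es p q) with ⊳-unbang-lam L e p
... | L' , t₁ , R , refl , refl = sub L' _ , t₁ , sub R q , refl , refl

⊳-ren : (ρ : Fin n → Fin m) → b ⊳ t → renB ρ b ⊳ renV ρ t
⊳-ren ρ (var x)      = var (ρ x)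
⊳-ren ρ (lam t)      = subst (λ z → bang (lam (bang z)) ⊳ lam (renV (ext ρ) t)) (ᵛ-ren (ext ρ) t) (lam _)
⊳-ren ρ (es p q)     = es (⊳-ren (ext ρ) p) (⊳-ren ρ q)
⊳-ren ρ (app p q)    = app (⊳-ren ρ p) (⊳-ren ρ q)
⊳-ren ρ (app! p e q) = app! (⊳-ren ρ p) (unbang-ren ρ e) (⊳-ren ρ q)
⊳-ren ρ (der e p)    = der (unbang-ren ρ e) (⊳-ren ρ p)

⊳-subst : σ' ≈ᵛ σ → b ⊳ t → substB σ' b ⊳ substV σ t
⊳-subst {σ = σ} h (var x) = subst (_⊳ σ x) (sym (h x)) (⊳-refl (σ x))
⊳-subst {σ = σ} h (lam t) =
  subst (λ z → bang (lam (bang z)) ⊳ lam (substV (extsV σ) t)) (ᵛ-subst (exts-≈ᵛ h) t) (lam _)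
⊳-subst h (es p q)     = es (⊳-subst (exts-≈ᵛ h) p) (⊳-subst h q)
⊳-subst h (app p q)    = app (⊳-subst h p) (⊳-subst h q)
⊳-subst h (app! p e q) = app! (⊳-subst h p) (unbang-subst _ e) (⊳-subst h q)
⊳-subst h (der e p)    = der (unbang-subst _ e) (⊳-subst h p)

⊳-s!-contractum : b ⊳ t → L ⊳L L' → bang w ⊳ v →
  plugB L (renB (ext (wkBL L)) b B[0:= w ]) ⊳ plugV L' (renV (ext (wkVL L')) t V[0:= v ])
⊳-s!-contractum {t = t} {L = L} {v = v} p R pw =
  ⊳-plug R (⊳-subst {σ = topV v} (top-≈ᵛ (⊳-bang-ᵛ pw))
    (subst (renB (ext (wkBL L)) _ ⊳_) (renV-cong (ext-cong (⊳L-wk R)) t) (⊳-ren (ext (wkBL L)) p)))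

⊳-dB-contractum : (t : VTm (suc m)) → L ⊳L L' → c ⊳ u →
  der (plugB L (es (bang (t ᵛ)) (renB (wkBL L) c))) ⊳ plugV L' (es t (renV (wkVL L') u))
⊳-dB-contractum {L = L} {u = u} t R q =
  der (unbang-plug L (es _ (bang (t ᵛ))))
      (⊳-plug R (es (⊳-refl t) (subst (renB (wkBL L) _ ⊳_) (renV-cong (⊳L-wk R) u) (⊳-ren (wkBL L) q))))

unbang-step⁻¹ : b ⊳ t → Unbang b r → BStep κ r r' → ∃ λ b' → BStep κ b b' × Unbang b' r'
unbang-step⁻¹ (var x)  (bang _) (root ())
unbang-step⁻¹ (lam t)  (bang _) (root ())
unbang-step⁻¹ (lam t)  (bang _) (lamS (root ()))
unbang-step⁻¹ (es p q) (es c e) (root (r-s! _ L w)) = _ , root (r-s! _ L w) , unbang-s!-contractum L w e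
unbang-step⁻¹ (es p q) (es c e) (esL s) with unbang-step⁻¹ p e s
... | _ , s' , e' = _ , esL s' , es c e'
unbang-step⁻¹ (es p q) (es c e) (esR s) = _ , esR s , es _ e

root-der : BRoot κ (der a) b → Unbang a b
root-der (r-d! L s) = unbang-plug L (bang s)

no-root-step-der-app : BRoot κ (der (app a c)) b → ⊥
no-root-step-der-app rt with root-der rt
... | ()

root-app : BRoot κ (app a c) b → ∃ λ m → Σ (BL _ m) λ L → ∃ λ body → a ≡ plugB L (lam body)
root-app (r-dB L t _) = _ , L , t , refl

no-root-step-app-der : BRoot κ (app (der a) c) b → ⊥
no-root-step-app-der rt with root-app rt
... | _ , hole    , _ , ()
... | _ , sub _ _ , _ , ()

⊳-d!-nf⇒ᵛ : b ⊳ t → Bd!NF b → b ≡ t ᵛ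
⊳-d!-nf⇒ᵛ (var x)  _  = refl
⊳-d!-nf⇒ᵛ (lam t)  _  = refl
⊳-d!-nf⇒ᵛ (es p q) nf =
  cong₂ es (⊳-d!-nf⇒ᵛ p λ (_ , s) → nf (_ , esL s)) (⊳-d!-nf⇒ᵛ q λ (_ , s) → nf (_ , esR s))
⊳-d!-nf⇒ᵛ (app {b = b} {t = t} {c = c} {u = u} p q) nf = begin
  der (app (der b) c)         ≡⟨ cong₂ (λ x y → der (app (der x) y)) b≡tᵛ c≡uᵛ ⟩
  der (app (der (t ᵛ)) (u ᵛ)) ≡⟨ sym (appᵛ-stuck (u ᵛ) stuck) ⟩
  app t u ᵛ                   ∎
  where
  open ≡-Reasoning
  b≡tᵛ : b ≡ t ᵛ
  b≡tᵛ = ⊳-d!-nf⇒ᵛ p λ (_ , s) → nf (_ , derS (appL (derS s)))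
  c≡uᵛ : c ≡ u ᵛ
  c≡uᵛ = ⊳-d!-nf⇒ᵛ q λ (_ , s) → nf (_ , derS (appR s))
  stuck : ¬ Unbangable (t ᵛ)
  stuck (_ , e) = nf (_ , derS (appL (unbang-d! (subst (λ z → Unbang z _) (sym b≡tᵛ) e))))
⊳-d!-nf⇒ᵛ (app! {t = t} {r = r} {u = u} p e q) nf = begin
  der (app r _)     ≡⟨ cong (λ y → der (app r y)) c≡uᵛ ⟩
  der (app r (u ᵛ)) ≡⟨ sym (appᵛ-unbang (u ᵛ) (subst (λ z → Unbang z r) b≡tᵛ e)) ⟩
  app t u ᵛ         ∎
  where
  open ≡-Reasoning
  b≡tᵛ = ⊳-d!-nf⇒ᵛ p λ (_ , s) → let (_ , _ , s') = unbang-step e s in nf (_ , derS (appL s'))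
  c≡uᵛ = ⊳-d!-nf⇒ᵛ q λ (_ , s) → nf (_ , derS (appR s))
⊳-d!-nf⇒ᵛ (der e p) nf = ⊥-elim (nf (_ , unbang-d! e))

ᵛ-d!-normal : (t : VTm n) → Bd!NF (t ᵛ)
ᵛ-d!-normal (var x)  (_ , root ())
ᵛ-d!-normal (lam t)  (_ , root ())
ᵛ-d!-normal (es t u) (_ , root ())
ᵛ-d!-normal (es t u) (_ , esL s) = ᵛ-d!-normal t (_ , s)
ᵛ-d!-normal (es t u) (_ , esR s) = ᵛ-d!-normal u (_ , s)
ᵛ-d!-normal (app t u) = appᵛ-elim Bd!NF (t ᵛ) (u ᵛ) unbanged stuck
  where
  unbanged : Unbang (t ᵛ) r → Bd!NF (der (app r (u ᵛ)))
  unbanged e (_ , root rt)          = no-root-step-der-app rt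
  unbanged e (_ , derS (root ()))
  unbanged e (_ , derS (appL s)) with unbang-step⁻¹ (⊳-refl t) e s
  ... | _ , s' , _ = ᵛ-d!-normal t (_ , s')
  unbanged e (_ , derS (appR s))    = ᵛ-d!-normal u (_ , s)
  stuck : ¬ Unbangable (t ᵛ) → Bd!NF (der (app (der (t ᵛ)) (u ᵛ)))
  stuck ¬e (_ , root rt)                 = no-root-step-der-app rt
  stuck ¬e (_ , derS (root ()))
  stuck ¬e (_ , derS (appL (root rt)))   = ¬e (_ , root-der rt)
  stuck ¬e (_ , derS (appL (derS s)))    = ᵛ-d!-normal t (_ , s)
  stuck ¬e (_ , derS (appR s))           = ᵛ-d!-normal u (_ , s)

data Mirror : BRule → VTm n → VTm n → Set where
  dB : VStep dB t t' → Mirror dB t t'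
  s! : VStep sV t t' → Mirror s! t t'
  d! : Mirror d! t t

Reflected : BRule → VTm n → BTm n → Set
Reflected κ t b' = ∃ λ t' → Mirror κ t t' × b' ⊳ t'

reflected-map : (g : VTm n → VTm m) → (∀ {ρ t t'} → VStep ρ t t' → VStep ρ (g t) (g t')) →
                (∀ {t'} → b' ⊳ t' → c' ⊳ g t') → Reflected κ t b' → Reflected κ (g t) c'
reflected-map g G H (t' , dB s , p) = g t' , dB (G s) , H p
reflected-map g G H (t' , s! s , p) = g t' , s! (G s) , H p
reflected-map g G H (t' , d!   , p) = g t' , d!       , H p

⊳-reflect-step : b ⊳ t → BStep κ b b' → Reflected κ t b'
⊳-reflect-step (var x) (root ())
⊳-reflect-step (lam t) (root ())
⊳-reflect-step (es {t = t} p q) (root (r-s! _ L w)) with ⊳-plug⁻¹ L q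
... | L' , v , R , refl , pw = _ , s! (root (r-sV t L' v (⊳-bang-value pw))) , ⊳-s!-contractum p R pw
⊳-reflect-step (es p q) (esL s) = reflected-map (λ z → es z _) esL (λ p' → es p' q) (⊳-reflect-step p s)
⊳-reflect-step (es p q) (esR s) = reflected-map (es _) esR (es p) (⊳-reflect-step q s)
⊳-reflect-step (app p q) (root rt)        = ⊥-elim (no-root-step-der-app rt)
⊳-reflect-step (app p q) (derS (root rt)) = ⊥-elim (no-root-step-app-der rt)
⊳-reflect-step (app p q) (derS (appL (root (r-d! L s)))) = _ , d! , app! p (unbang-plug L (bang s)) q
⊳-reflect-step (app p q) (derS (appL (derS s))) =
  reflected-map (λ z → app z _) appL (λ p' → app p' q) (⊳-reflect-step p s)
⊳-reflect-step (app p q) (derS (appR s)) = reflected-map (app _) appR (app p) (⊳-reflect-step q s)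
⊳-reflect-step (app! p e q) (root rt) = ⊥-elim (no-root-step-der-app rt)
⊳-reflect-step (app! {u = u} p e q) (derS (root (r-dB L _ _))) with ⊳-unbang-lam L e p
... | L' , t₁ , R , refl , refl = _ , dB (root (r-dB L' t₁ u)) , ⊳-dB-contractum t₁ R q
⊳-reflect-step (app! p e q) (derS (appL s)) with unbang-step⁻¹ p e s
... | _ , s' , e' = reflected-map (λ z → app z _) appL (λ p' → app! p' e' q) (⊳-reflect-step p s')
⊳-reflect-step (app! p e q) (derS (appR s)) =
  reflected-map (app _) appR (λ q' → app! p e q') (⊳-reflect-step q s)
⊳-reflect-step (der e p) (root (r-d! L s)) =
  _ , d! , subst (_⊳ _) (unbang-unique e (unbang-plug L (bang s))) p
⊳-reflect-step (der e p) (derS s) with unbang-step e s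
... | _ , e' , s' = reflected-map (λ z → z) (λ s → s) (der e') (⊳-reflect-step p s')

_◅ᴹ_ : Mirror κ t t₁ → t₁ →V*[ k , l ] t' → t →V*[ hit dB κ + k , hit s! κ + l ] t'
dB s ◅ᴹ (σ , refl , refl) = (dB , s) ◅ σ , refl , refl
s! s ◅ᴹ (σ , refl , refl) = (sV , s) ◅ σ , refl , refl
d!   ◅ᴹ σ                 = σ

⊳-reflect : b ⊳ t → (τ : b →S* b') → ∃ λ t' → b' ⊳ t' × t →V*[ countB dB τ , countB s! τ ] t'
⊳-reflect p ε = _ , p , ε , refl , refl
⊳-reflect p ((κ , s) ◅ τ) with ⊳-reflect-step p s
... | _ , m , p₁ with ⊳-reflect p₁ τ
... | t' , p' , σ rewrite countB-◅ dB s τ | countB-◅ s! s τ = t' , p' , m ◅ᴹ σ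

ᵛ-stable : (t : VTm n) → (t ᵛ) →S* b → Bd!NF b → ∃ λ s → b ≡ s ᵛ
ᵛ-stable t τ nf with ⊳-reflect (⊳-refl t) τ
... | s , p , _ = s , ⊳-d!-nf⇒ᵛ p nf

ᵛ-reflects : (τ : (t ᵛ) →S* (u ᵛ)) → t →V*[ countB dB τ , countB s! τ ] u
ᵛ-reflects {t = t} {u = u} τ with ⊳-reflect (⊳-refl t) τ
... | t' , p , σ = subst (t →V*[ _ , _ ]_) (trans (sym (⊳-erase p)) (erase-ᵛ u)) σ

→S*-nonempty : (τ : a →S* b) → countB κ τ ≡ suc k → ∃ (a →S_)
→S*-nonempty ε ()
→S*-nonempty (s ◅ _) _ = _ , s

VNF⇔BNF-ᵛ : (t : VTm n) → VNF t ⇔ BNF (t ᵛ)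
VNF⇔BNF-ᵛ t = mk⇔ to from
  where
  to : VNF t → BNF (t ᵛ)
  to nf (_ , _ , s) with ⊳-reflect-step (⊳-refl t) s
  ... | t' , dB s' , _ = nf (t' , dB , s')
  ... | t' , s! s' , _ = nf (t' , sV , s')
  ... | _  , d!    , _ = ᵛ-d!-normal t (_ , s)
  from : BNF (t ᵛ) → VNF t
  from nf (_ , dB , s) = let (τ , one , _) = ᵛ-simulates-step s in nf (→S*-nonempty τ one)
  from nf (_ , sV , s) = let (τ , _ , one) = ᵛ-simulates-step s in nf (→S*-nonempty τ one)

corollary4 : ∀ {n} →
    -- 1. stability
    (∀ (t : VTm n) (s' : BTm n) → (t ᵛ) →S* s' → Bd!NF s' → ∃ λ (s : VTm n) → s' ≡ s ᵛ)
    -- 2. normal forms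
    × (∀ (t : VTm n) → VNF t ⇔ BNF (t ᵛ))
    -- 3. simulations, with step counts
    × (∀ (t u : VTm n) →
        ((t →V* u) ⇔ ((t ᵛ) →S* (u ᵛ)))
        × (∀ (σ : t →V* u) → Σ ((t ᵛ) →S* (u ᵛ)) λ τ →
             countB dB τ ≡ countV dB σ × countB s! τ ≡ countV sV σ)
        × (∀ (τ : (t ᵛ) →S* (u ᵛ)) → Σ (t →V* u) λ σ →
             countV dB σ ≡ countB dB τ × countV sV σ ≡ countB s! τ))
corollary4 =
    (λ t _ → ᵛ-stable t)
  , VNF⇔BNF-ᵛ
  , λ t u → mk⇔ (λ σ → proj₁ (ᵛ-simulates σ)) (λ τ → proj₁ (ᵛ-reflects τ)) , ᵛ-simulates , ᵛ-reflects
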